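{- Let $P$ be an integer and $m\ge 0$ an integer, and let $\sigma_2(n)=\sum_{d\mid n} d^2$ (sum over positive divisors). Then, apart from finitely many (computable) solutions, all of which satisfy $n\le \big(|V_{2m}(P,-1)|+U_{2m}^2(P,-1)-1\big)^3$, every positive integer solution $n$ of $$\sigma_2(n)-n^2=V_{2m}(P,-1)\,n-U_{2m}^2(P,-1)+1$$ is of one of the following forms: (1) $n=U_{2k+1}(P,-1)\,U_{2k+2m+1}(P,-1)$ for some integer $k\ge 0$, with $U_{2k+1}(P,-1)$ and $U_{2k+2m+1}(P,-1)$ both primes; (2) $n=U_{2k+1}(P,-1)\,U_{2m-2k-1}(P,-1)$ for some integer $k\ge 0$ with $2m-2k-1\ge 0$ and $m\neq 2k+1$, with $U_{2k+1}(P,-1)$ and $U_{2m-2k-1}(P,-1)$ both primes.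
   Context: For integers $P,Q$, the Lucas sequence of the first kind is defined by $U_0(P,Q)=0$, $U_1(P,Q)=1$, $U_n(P,Q)=P\,U_{n-1}(P,Q)-Q\,U_{n-2}(P,Q)$ for $n>1$. The Lucas sequence of the second kind is $V_0(P,Q)=2$, $V_1(P,Q)=P$, $V_n(P,Q)=P\,V_{n-1}(P,Q)-Q\,V_{n-2}(P,Q)$ for $n>1$. -}

module Defs where

open import Data.Nat as ℕ using (ℕ; zero; suc)
open import Data.Nat.Divisibility using (_∣?_)
open import Data.Nat.Primality using (Prime)
open import Data.List using (List; map; filter; upTo)
open import Data.Nat.ListAction using (sum)
open import Data.Integer using (ℤ; +_; _+_; _-_; _*_)
open import Data.Product using (Σ; _×_)
open import Relation.Binary.PropositionalEquality using (_≡_)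

Upair : ℤ → ℤ → ℕ → ℤ × ℤ
Upair P Q zero = (+ 0) Data.Product., (+ 1)
Upair P Q (suc n) with Upair P Q n
... | (a Data.Product., b) = b Data.Product., (P * b - Q * a)

U : ℤ → ℤ → ℕ → ℤ
U P Q n = Data.Product.proj₁ (Upair P Q n)

Vpair : ℤ → ℤ → ℕ → ℤ × ℤ
Vpair P Q zero = (+ 2) Data.Product., P
Vpair P Q (suc n) with Vpair P Q n
... | (a Data.Product., b) = b Data.Product., (P * b - Q * a)

V : ℤ → ℤ → ℕ → ℤ
V P Q n = Data.Product.proj₁ (Vpair P Q n)

σ₂ : ℕ → ℕ
σ₂ n = sum (map (λ d → d ℕ.* d) (filter (_∣? n) (map suc (upTo n))))

IsPrimeℤ : ℤ → Set
IsPrimeℤ x = Σ ℕ (λ p → Prime p × x ≡ + p)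

{-# OPTIONS --safe #-}
-- At even indices U_n(P,-1)² and V_n(P,-1) depend only on p = |P|, so the equation becomes
-- σ₂(n) + U² = n² + V n + 1 over ℕ with U = U_{2m}, V = V_{2m}. Let a be the least prime factor of
-- n = d a. If n is a prime or the square of a prime, or if d ≥ a², the divisors 1, a, d, n already
-- force n ≤ (V + U² − 1)³. Otherwise a < d are primes with a² + d² + U² = V a d. For m ≥ 1,
-- A = U_{2m+1} and B = U_{2m−1} satisfy V = A + B and A B = U² + 1, so (d − A a)(d − B a) = U² (a² − 1).
-- Hence d lies outside (B a, A a), its distance to the nearer root is z U with a² − p a z − z² = 1,
-- and a descent shows that such pairs are consecutive Lucas numbers; d'Ocagne's identity then
-- identifies d. When U = 0 (p = 0 or m = 0) we have V = 2, and a² + d² = 2 a d is impossible.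

module Submission where

module Arithmetic where
  open import Defs using (σ₂)
  open import Data.Nat using (ℕ; zero; suc; _+_; _*_; _∸_; _^_; _≤_; _<_; _≤?_; _≟_; z≤n; s≤s; NonZero; ≢-nonZero; ≢-nonZero⁻¹; >-nonZero; >-nonZero⁻¹; n>1⇒nonTrivial; nonTrivial⇒n>1)
  open import Data.Nat.Properties
  open import Data.Nat.Divisibility
  open import Data.Nat.DivMod using (_/_; m/n*n≡m)
  open import Data.Nat.GCD using (gcd; gcd[m,n]∣m; gcd[m,n]∣n; gcd[m,n]≡0⇒n≡0)
  open import Data.Nat.Coprimality using (coprime-/gcd; coprime-divisor)
  import Data.Nat.Coprimality as Coprime
  open import Data.Nat.Primality using (Prime; _Rough_; 2-rough; ∤⇒rough-suc; rough∧∣⇒prime; euclidsLemma; prime⇒irreducible; prime⇒nonZero; prime⇒nonTrivial)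
  open import Data.Nat.ListAction using (sum)
  open import Data.Nat.Tactic.RingSolver using (solve-∀)
  open import Data.List using ([]; _∷_; map; filter; upTo; _++_; [_])
  open import Data.List.Properties using (map-++; upTo-∷ʳ)
  open import Data.Nat.ListAction.Properties using (sum-++)
  open import Data.Product using (∃; _×_; _,_)
  open import Data.Sum using (_⊎_; inj₁; inj₂)
  open import Data.Empty using (⊥-elim)
  open import Relation.Nullary using (Dec; yes; no; ¬_; contradiction)
  open import Relation.Binary.PropositionalEquality hiding ([_])

  -- u p n = U_n(p,-1) and v p n = V_n(p,-1) for p ≥ 0, as natural numbers.
  u : ℕ → ℕ → ℕ
  u p 0 = 0
  u p 1 = 1
  u p (suc (suc n)) = p * u p (suc n) + u p n

  v : ℕ → ℕ → ℕ
  v p 0 = 2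
  v p 1 = p
  v p (suc (suc n)) = p * v p (suc n) + v p n

  double : ℕ → ℕ
  double zero = zero
  double (suc k) = suc (suc (double k))

  double≡2* : ∀ k → double k ≡ 2 * k
  double≡2* zero = refl
  double≡2* (suc k) = cong suc (trans (cong suc (double≡2* k)) (sym (+-suc k (k + 0))))

  double-+ : ∀ k l → double (k + l) ≡ double k + double l
  double-+ zero l = refl
  double-+ (suc k) l = cong (λ t → suc (suc t)) (double-+ k l)

  module _ (p : ℕ) where

    u-+ : ∀ i j → u p (suc (i + j)) ≡ u p (suc i) * u p (suc j) + u p i * u p j
    u-+ zero j = sym (trans (+-identityʳ _) (+-identityʳ _))
    u-+ (suc zero) j = identity p (u p (suc j)) (u p j)
      where
      identity : ∀ p x y → p * x + y ≡ (p * 1 + 0) * x + 1 * y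
      identity = solve-∀
    u-+ (suc (suc i)) j rewrite u-+ (suc i) j | u-+ i j =
      identity p (u p (suc i)) (u p i) (u p (suc j)) (u p j)
      where
      identity : ∀ p a b c d →
        p * ((p * a + b) * c + a * d) + (a * c + b * d) ≡ (p * (p * a + b) + a) * c + (p * a + b) * d
      identity = solve-∀

    v≡u+u : ∀ n → v p (suc n) ≡ u p (suc (suc n)) + u p n
    v≡u+u zero = sym (trans (+-identityʳ _) (trans (+-identityʳ _) (*-identityʳ p)))
    v≡u+u (suc zero) = identity p
      where
      identity : ∀ p → p * p + 2 ≡ p * (p * 1 + 0) + 1 + 1
      identity = solve-∀
    v≡u+u (suc (suc n)) rewrite v≡u+u (suc n) | v≡u+u n =
      identity p (u p (suc (suc (suc n)))) (u p (suc n)) (u p (suc (suc n))) (u p n)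
      where
      identity : ∀ p a b c d → p * (a + b) + (c + d) ≡ (p * a + c) + (p * b + d)
      identity = solve-∀

    private
      X Y : ℕ → ℕ → ℕ
      X a b = u p (suc (a + b)) * u p a
      Y a b = u p (a + b) * u p (suc a)

      X-Y-alternates : ∀ a b → X (suc a) b + X a b ≡ Y (suc a) b + Y a b
      X-Y-alternates a b = identity p (u p (suc (a + b))) (u p (a + b)) (u p (suc a)) (u p a)
        where
        identity : ∀ p c d e f → (p * c + d) * e + c * f ≡ c * (p * e + f) + d * e
        identity = solve-∀

    ocagne-even : ∀ i j → u p (suc (double i + j)) * u p (double i) + u p j ≡ u p (double i + j) * u p (suc (double i))
    ocagne-odd : ∀ i j →
      u p (suc (suc (double i) + j)) * u p (suc (double i)) ≡ u p (suc (double i) + j) * u p (suc (suc (double i))) + u p j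
    ocagne-even zero j rewrite *-zeroʳ (u p (suc j)) | *-identityʳ (u p j) = refl
    ocagne-even (suc i) j = +-cancelʳ-≡ (Y a j) _ _ (begin
      X (suc a) j + u p j + Y a j    ≡⟨ +-assoc (X (suc a) j) _ _ ⟩
      X (suc a) j + (u p j + Y a j)  ≡⟨ cong (X (suc a) j +_) (+-comm (u p j) _) ⟩
      X (suc a) j + (Y a j + u p j)  ≡⟨ cong (X (suc a) j +_) (sym (ocagne-odd i j)) ⟩
      X (suc a) j + X a j            ≡⟨ X-Y-alternates a j ⟩
      Y (suc a) j + Y a j            ∎)
      where
      open ≡-Reasoning
      a = suc (double i)
    ocagne-odd i j = +-cancelʳ-≡ (X a j) _ _ (begin
      X (suc a) j + X a j            ≡⟨ X-Y-alternates a j ⟩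
      Y (suc a) j + Y a j            ≡⟨ cong (Y (suc a) j +_) (sym (ocagne-even i j)) ⟩
      Y (suc a) j + (X a j + u p j)  ≡⟨ cong (Y (suc a) j +_) (+-comm _ (u p j)) ⟩
      Y (suc a) j + (u p j + X a j)  ≡⟨ sym (+-assoc (Y (suc a) j) _ _) ⟩
      Y (suc a) j + u p j + X a j    ∎)
      where
      open ≡-Reasoning
      a = double i

    cassini-odd : ∀ i →
      u p (suc (suc (suc (double i)))) * u p (suc (double i)) ≡ u p (suc (suc (double i))) * u p (suc (suc (double i))) + 1
    cassini-odd i = subst (λ t → u p (suc t) * u p (suc (double i)) ≡ u p t * u p (suc (suc (double i))) + 1)
      (+-comm (suc (double i)) 1) (ocagne-odd i 1)

    u-suc-pos : 1 ≤ p → ∀ n → 1 ≤ u p (suc n)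
    u-suc-pos p≥1 zero = ≤-refl
    u-suc-pos p≥1 (suc n) = ≤-trans (*-mono-≤ p≥1 (u-suc-pos p≥1 n)) (m≤m+n _ _)

    v-even≥2 : ∀ k → 2 ≤ v p (double k)
    v-even≥2 zero = ≤-refl
    v-even≥2 (suc k) = ≤-trans (v-even≥2 k) (m≤n+m _ _)

  u-even≡0⇒v-even≡2 : ∀ p m → u p (double m) ≡ 0 → v p (double m) ≡ 2
  u-even≡0⇒v-even≡2 p zero _ = refl
  u-even≡0⇒v-even≡2 zero (suc m) _ = v[0]-even m
    where
    v[0]-even : ∀ m → v 0 (double m) ≡ 2
    v[0]-even zero = refl
    v[0]-even (suc m) = v[0]-even m
  u-even≡0⇒v-even≡2 (suc p) (suc m) u≡0 =
    contradiction (subst (1 ≤_) u≡0 (u-suc-pos (suc p) (s≤s z≤n) (suc (double m)))) λ ()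

  u[0]-even : ∀ m → u 0 (double m) ≡ 0
  u[0]-even zero = refl
  u[0]-even (suc m) = u[0]-even m

  -- The positive solutions of x² − p x z − z² = ±1 are consecutive terms of u p:
  -- (x, z) ↦ (z, x − p z) exchanges the two signs and strictly decreases x + z.
  module Descent (p : ℕ) (p≥1 : 1 ≤ p) where

    private
      common : ℕ → ℕ → ℕ
      common z w = p * z * (p * z) + p * z * w

      swap-+1 : ∀ z w → (p * z + w) * (p * z + w) ≡ p * (p * z + w) * z + z * z + 1 →
                z * z + 1 ≡ p * z * w + w * w
      swap-+1 z w h = +-cancelʳ-≡ (common z w) _ _ (begin
        z * z + 1 + common z w           ≡⟨ identity₁ p z w ⟩
        p * (p * z + w) * z + z * z + 1  ≡⟨ sym h ⟩
        (p * z + w) * (p * z + w)        ≡⟨ identity₂ p z w ⟩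
        p * z * w + w * w + common z w   ∎)
        where
        open ≡-Reasoning
        identity₁ : ∀ p z w → z * z + 1 + (p * z * (p * z) + p * z * w) ≡ p * (p * z + w) * z + z * z + 1
        identity₁ = solve-∀
        identity₂ : ∀ p z w → (p * z + w) * (p * z + w) ≡ p * z * w + w * w + (p * z * (p * z) + p * z * w)
        identity₂ = solve-∀

      swap-−1 : ∀ z w → (p * z + w) * (p * z + w) + 1 ≡ p * (p * z + w) * z + z * z →
                z * z ≡ p * z * w + w * w + 1
      swap-−1 z w h = +-cancelʳ-≡ (common z w) _ _ (begin
        z * z + common z w                  ≡⟨ identity₁ p z w ⟩
        p * (p * z + w) * z + z * z         ≡⟨ sym h ⟩
        (p * z + w) * (p * z + w) + 1       ≡⟨ identity₂ p z w ⟩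
        p * z * w + w * w + 1 + common z w  ∎)
        where
        open ≡-Reasoning
        identity₁ : ∀ p z w → z * z + (p * z * (p * z) + p * z * w) ≡ p * (p * z + w) * z + z * z
        identity₁ = solve-∀
        identity₂ : ∀ p z w → (p * z + w) * (p * z + w) + 1 ≡ p * z * w + w * w + 1 + (p * z * (p * z) + p * z * w)
        identity₂ = solve-∀

      x*y≤pxz : ∀ x y z → y ≤ p * z → x * y ≤ p * x * z
      x*y≤pxz x y z y≤pz = ≤-trans (*-monoʳ-≤ x y≤pz) (≤-reflexive (identity p x z))
        where
        identity : ∀ p x z → x * (p * z) ≡ p * x * z
        identity = solve-∀

      small-x-+1 : ∀ x z → x < p * z → x * x < p * x * z + z * z + 1
      small-x-+1 x z x<pz =
        ≤-<-trans (≤-trans (x*y≤pxz x x z (<⇒≤ x<pz)) (m≤m+n _ _)) (m<m+n _ (s≤s z≤n))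

      small-x-−1 : ∀ x z → 1 ≤ x → 1 ≤ z → x < p * z → x * x + 1 < p * x * z + z * z
      small-x-−1 x z x≥1 z≥1 x<pz = begin-strict
        x * x + 1          ≤⟨ +-monoʳ-≤ (x * x) x≥1 ⟩
        x * x + x          ≡⟨ trans (+-comm (x * x) x) (sym (*-suc x x)) ⟩
        x * suc x          ≤⟨ x*y≤pxz x (suc x) z x<pz ⟩
        p * x * z          <⟨ m<m+n _ (*-mono-≤ z≥1 z≥1) ⟩
        p * x * z + z * z  ∎
        where open ≤-Reasoning

      shrinks : ∀ f z w → 1 ≤ z → p * z + w + z ≤ suc f → z + w ≤ f
      shrinks f z w z≥1 le = ≤-pred (begin-strict
        z + w          <⟨ +-monoʳ-< z (m<n+m w (*-mono-≤ p≥1 z≥1)) ⟩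
        z + (p * z + w) ≡⟨ +-comm z _ ⟩
        p * z + w + z  ≤⟨ le ⟩
        suc f          ∎)
        where open ≤-Reasoning

      descent-+1 : ∀ f x z → x + z ≤ f → x * x ≡ p * x * z + z * z + 1 →
                   ∃ λ k → x ≡ u p (suc (double k)) × z ≡ u p (double k)
      descent-−1 : ∀ f x z → x + z ≤ f → 1 ≤ x → x * x + 1 ≡ p * x * z + z * z →
                   ∃ λ k → x ≡ u p (suc (suc (double k))) × z ≡ u p (suc (double k))

      descent-+1 f x zero _ h rewrite *-zeroʳ (p * x) = 0 , m*n≡1⇒m≡1 x x h , refl
      descent-+1 zero x (suc z) le h = contradiction (m+n≤o⇒n≤o x le) λ ()
      descent-+1 (suc f) x z@(suc _) le h with p * z ≤? x
      ... | no pz≰x = ⊥-elim (<-irrefl h (small-x-+1 x z (≰⇒> pz≰x)))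
      ... | yes pz≤x with m≤n⇒∃[o]m+o≡n pz≤x
      ... | w , refl with descent-−1 f z w (shrinks f z w (s≤s z≤n) le) (s≤s z≤n) (swap-+1 z w h)
      ... | k , z≡ , w≡ = suc k , cong₂ (λ a b → p * a + b) z≡ w≡ , z≡

      descent-−1 f x zero _ _ h rewrite *-zeroʳ (p * x) = contradiction (trans (+-comm 1 (x * x)) h) λ ()
      descent-−1 zero x (suc z) le _ h = contradiction (m+n≤o⇒n≤o x le) λ ()
      descent-−1 (suc f) x z@(suc _) le x≥1 h with p * z ≤? x
      ... | no pz≰x = ⊥-elim (<-irrefl h (small-x-−1 x z x≥1 (s≤s z≤n) (≰⇒> pz≰x)))
      ... | yes pz≤x with m≤n⇒∃[o]m+o≡n pz≤x
      ... | w , refl with descent-+1 f z w (shrinks f z w (s≤s z≤n) le) (swap-−1 z w h)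
      ... | k , z≡ , w≡ = k , cong₂ (λ a b → p * a + b) z≡ w≡ , z≡

    norm+1⇒consecutive : ∀ x z → x * x ≡ p * x * z + z * z + 1 →
                         ∃ λ k → x ≡ u p (suc (double k)) × z ≡ u p (double k)
    norm+1⇒consecutive x z = descent-+1 (x + z) x z ≤-refl

    norm−1⇒consecutive : ∀ x z → 1 ≤ x → x * x + 1 ≡ p * x * z + z * z →
                         ∃ λ k → x ≡ u p (suc (suc (double k))) × z ≡ u p (suc (double k))
    norm−1⇒consecutive x z = descent-−1 (x + z) x z ≤-refl

  -- Divide out g = gcd n m: then m/g is coprime to n/g and divides (n/g)², so m/g = 1.
  m*m∣n*[n+m*c]⇒m∣n : ∀ m n c → .{{NonZero m}} → m * m ∣ n * (n + m * c) → m ∣ n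
  m*m∣n*[n+m*c]⇒m∣n m n c m²∣ = subst (_∣ n) (sym m≡g) (gcd[m,n]∣m n m)
    where
    g = gcd n m
    instance
      g≢0 : NonZero g
      g≢0 = ≢-nonZero (λ g≡0 → ≢-nonZero⁻¹ m (gcd[m,n]≡0⇒n≡0 n g≡0))
      g*g≢0 : NonZero (g * g)
      g*g≢0 = m*n≢0 g g
    n′ = n / g
    m′ = m / g
    n′*g≡n : n′ * g ≡ n
    n′*g≡n = m/n*n≡m (gcd[m,n]∣m n m)
    m′*g≡m : m′ * g ≡ m
    m′*g≡m = m/n*n≡m (gcd[m,n]∣n n m)
    m′²∣ : m′ * m′ ∣ n′ * (n′ + m′ * c)
    m′²∣ = *-cancelʳ-∣ (g * g) (subst₂ _∣_ (identity₁ m′ g) (identity₂ n′ m′ g c)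
             (subst₂ (λ a b → b * b ∣ a * (a + b * c)) (sym n′*g≡n) (sym m′*g≡m) m²∣))
      where
      identity₁ : ∀ m g → (m * g) * (m * g) ≡ m * m * (g * g)
      identity₁ = solve-∀
      identity₂ : ∀ n m g c → (n * g) * (n * g + m * g * c) ≡ n * (n + m * c) * (g * g)
      identity₂ = solve-∀
    m′∣n′² : m′ ∣ n′ * n′
    m′∣n′² = ∣m+n∣m⇒∣n (∣-trans (m∣m*n m′) (subst (m′ * m′ ∣_) (identity n′ m′ c) m′²∣)) (m∣m*n (n′ * c))
      where
      identity : ∀ n m c → n * (n + m * c) ≡ m * (n * c) + n * n
      identity = solve-∀
    m′≡1 : m′ ≡ 1
    m′≡1 = coprime-/gcd n m (coprime-divisor (Coprime.sym (coprime-/gcd n m)) m′∣n′² , ∣-refl)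
    m≡g : m ≡ g
    m≡g = trans (sym m′*g≡m) (trans (cong (_* g) m′≡1) (+-identityʳ g))

  offset-divisible : ∀ p U a F → .{{NonZero U}} → F * (F + p * U * a) + U * U ≡ U * U * (a * a) →
                     ∃ λ z → F ≡ z * U × z * (z + p * a) + 1 ≡ a * a
  offset-divisible p U a F eq = quotient-solves (m*m∣n*[n+m*c]⇒m∣n U F (p * a) U²∣)
    where
    U²∣ : U * U ∣ F * (F + U * (p * a))
    U²∣ = subst (λ t → U * U ∣ F * (F + t)) (identity p U a)
            (∣m+n∣m⇒∣n (divides (a * a) (trans (+-comm (U * U) _) (trans eq (*-comm (U * U) _)))) ∣-refl)
      where
      identity : ∀ p U a → p * U * a ≡ U * (p * a)
      identity = solve-∀
    quotient-solves : U ∣ F → ∃ λ z → F ≡ z * U × z * (z + p * a) + 1 ≡ a * a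
    quotient-solves (divides z F≡zU) = z , F≡zU , *-cancelˡ-≡ _ _ (U * U) {{m*n≢0 U U}} (begin
      U * U * (z * (z + p * a) + 1)          ≡⟨ identity p U a z ⟩
      z * U * (z * U + p * U * a) + U * U    ≡⟨ cong (λ t → t * (t + p * U * a) + U * U) (sym F≡zU) ⟩
      F * (F + p * U * a) + U * U            ≡⟨ eq ⟩
      U * U * (a * a)                        ∎)
      where
      open ≡-Reasoning
      identity : ∀ p U a z → U * U * (z * (z + p * a) + 1) ≡ z * U * (z * U + p * U * a) + U * U
      identity = solve-∀

  vieta-partner : ∀ V U a d d′ → d + d′ ≡ V * a →
                  a * a + d * d + U * U ≡ V * a * d → a * a + d′ * d′ + U * U ≡ V * a * d′
  vieta-partner V U a d d′ sum eq = +-cancelʳ-≡ ((d + d′) * d) _ _ (begin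
    a * a + d′ * d′ + U * U + (d + d′) * d  ≡⟨ identity a d d′ U ⟩
    a * a + d * d + U * U + (d + d′) * d′   ≡⟨ cong₂ _+_ eq (cong (_* d′) sum) ⟩
    V * a * d + V * a * d′                  ≡⟨ cong (λ t → t * d + V * a * d′) (sym sum) ⟩
    (d + d′) * d + V * a * d′               ≡⟨ +-comm ((d + d′) * d) (V * a * d′) ⟩
    V * a * d′ + (d + d′) * d               ∎)
    where
    open ≡-Reasoning
    identity : ∀ a d d′ U → a * a + d′ * d′ + U * U + (d + d′) * d ≡ a * a + d * d + U * U + (d + d′) * d′
    identity = solve-∀

  -- With A = p U + B and A B = U² + 1, the equation a² + d² + U² = (A + B) a d says
  -- (d − A a)(d − B a) = U² (a² − 1) over ℤ; these lemmas are its cases over ℕ.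
  module Roots (p U B : ℕ) (cassini : (p * U + B) * B ≡ U * U + 1) where

    A : ℕ
    A = p * U + B

    beyond-larger-root : ∀ a F → a * a + (A * a + F) * (A * a + F) + U * U ≡ (A + B) * a * (A * a + F) →
                         F * (F + p * U * a) + U * U ≡ U * U * (a * a)
    beyond-larger-root a F eq = +-cancelˡ-≡ (R + a * a) _ _ (begin
      R + a * a + (F * (F + p * U * a) + U * U)  ≡⟨ identity₁ p U B a F ⟩
      L + A * B * (a * a)                        ≡⟨ cong₂ _+_ eq (cong (_* (a * a)) cassini) ⟩
      R + (U * U + 1) * (a * a)                  ≡⟨ identity₂ R a U ⟩
      R + a * a + U * U * (a * a)                ∎)
      where
      open ≡-Reasoning
      d = A * a + F
      L = a * a + d * d + U * U
      R = (A + B) * a * d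
      identity₁ : ∀ p U B a F → let A = p * U + B; d = A * a + F in
        (A + B) * a * d + a * a + (F * (F + p * U * a) + U * U) ≡ a * a + d * d + U * U + A * B * (a * a)
      identity₁ = solve-∀
      identity₂ : ∀ R a U → R + (U * U + 1) * (a * a) ≡ R + a * a + U * U * (a * a)
      identity₂ = solve-∀

    below-smaller-root : ∀ a d H → d + H ≡ B * a → a * a + d * d + U * U ≡ (A + B) * a * d →
                         H * (H + p * U * a) + U * U ≡ U * U * (a * a)
    below-smaller-root a d H d+H≡Ba eq =
      beyond-larger-root a H (vieta-partner (A + B) U a d (A * a + H) partner-sum eq)
      where
      partner-sum : d + (A * a + H) ≡ (A + B) * a
      partner-sum = begin
        d + (A * a + H)   ≡⟨ identity d H (A * a) ⟩
        A * a + (d + H)   ≡⟨ cong (A * a +_) d+H≡Ba ⟩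
        A * a + B * a     ≡⟨ sym (*-distribʳ-+ a A B) ⟩
        (A + B) * a       ∎
        where
        open ≡-Reasoning
        identity : ∀ d H x → d + (x + H) ≡ x + (d + H)
        identity = solve-∀

    between-roots : ∀ a G K → B * a + G + K ≡ A * a →
                    a * a + (B * a + G) * (B * a + G) + U * U ≡ (A + B) * a * (B * a + G) →
                    U * U * (a * a) + K * G ≡ U * U
    between-roots a G K Aa≡ eq = +-cancelˡ-≡ (R + a * a) _ _ (begin
      R + a * a + (U * U * (a * a) + K * G)                          ≡⟨ identity₁ R a U K G ⟩
      R + (U * U + 1) * (a * a) + K * G                              ≡⟨ cong (λ t → R + t + K * G) (sym ABa²≡) ⟩
      R + (β + G + K) * β + K * G                                    ≡⟨ cong (λ t → t + (β + G + K) * β + K * G) (sym eq′) ⟩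
      a * a + (β + G) * (β + G) + U * U + (β + G + K) * β + K * G    ≡⟨ identity₂ a β G K U ⟩
      R + a * a + U * U                                              ∎)
      where
      open ≡-Reasoning
      β = B * a
      R = ((β + G + K) + β) * (β + G)
      eq′ : a * a + (β + G) * (β + G) + U * U ≡ R
      eq′ = trans eq (cong (_* (β + G)) (trans (*-distribʳ-+ a A B) (cong (_+ β) (sym Aa≡))))
      ABa²≡ : (β + G + K) * β ≡ (U * U + 1) * (a * a)
      ABa²≡ = trans (cong (_* β) Aa≡) (trans (identity A B a) (cong (_* (a * a)) cassini))
        where
        identity : ∀ A B a → A * a * (B * a) ≡ A * B * (a * a)
        identity = solve-∀
      identity₁ : ∀ R a U K G → R + a * a + (U * U * (a * a) + K * G) ≡ R + (U * U + 1) * (a * a) + K * G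
      identity₁ = solve-∀
      identity₂ : ∀ a β G K U → a * a + (β + G) * (β + G) + U * U + (β + G + K) * β + K * G
                                ≡ ((β + G + K) + β) * (β + G) + a * a + U * U
      identity₂ = solve-∀

    no-root-between : ∀ a d → 1 ≤ a → B * a < d → d < A * a → a * a + d * d + U * U ≢ (A + B) * a * d
    no-root-between a d a≥1 Ba<d d<Aa eq with m≤n⇒∃[o]m+o≡n Ba<d | m≤n⇒∃[o]m+o≡n d<Aa
    ... | G , Ba+1+G≡d | K , d+1+K≡Aa = <-irrefl (sym (between-roots a (suc G) (suc K) Aa≡ eq′)) (begin-strict
      U * U                            ≡⟨ sym (*-identityʳ (U * U)) ⟩
      U * U * 1                        ≤⟨ *-monoʳ-≤ (U * U) (*-mono-≤ a≥1 a≥1) ⟩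
      U * U * (a * a)                  <⟨ m<m+n _ (s≤s z≤n) ⟩
      U * U * (a * a) + suc K * suc G  ∎)
      where
      open ≤-Reasoning
      d≡ : B * a + suc G ≡ d
      d≡ = trans (+-suc (B * a) G) Ba+1+G≡d
      Aa≡ : B * a + suc G + suc K ≡ A * a
      Aa≡ = trans (cong (_+ suc K) d≡) (trans (+-suc d K) d+1+K≡Aa)
      eq′ : a * a + (B * a + suc G) * (B * a + suc G) + U * U ≡ (A + B) * a * (B * a + suc G)
      eq′ = subst (λ d → a * a + d * d + U * U ≡ (A + B) * a * d) (sym d≡) eq

  -- Solutions of a² + d² + U_N² = V_N a d for N = 2(m + 1): the parameter m is one less than the paper's.
  module Solutions (p m : ℕ) (p≥1 : 1 ≤ p) where

    N : ℕ
    N = double (suc m)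

    U B : ℕ
    U = u p N
    B = u p (suc (double m))

    open Roots p U B (cassini-odd p m)
    open Descent p p≥1

    instance
      U≢0 : NonZero U
      U≢0 = >-nonZero (u-suc-pos p p≥1 (suc (double m)))

    right-of-roots : ∀ a F → a * a + (A * a + F) * (A * a + F) + U * U ≡ (A + B) * a * (A * a + F) →
                     ∃ λ k → a ≡ u p (suc (double k)) × A * a + F ≡ u p (suc (N + double k))
    right-of-roots a F eq =
      let z , F≡zU , norm = offset-divisible p U a F (beyond-larger-root a F eq)
          k , a≡ , z≡ = norm+1⇒consecutive a z (trans (sym norm) (identity p a z))
      in k , a≡ , (begin
        A * a + F                                    ≡⟨ cong (A * a +_) (trans F≡zU (*-comm z U)) ⟩
        A * a + U * z                                ≡⟨ cong₂ (λ x y → A * x + U * y) a≡ z≡ ⟩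
        A * u p (suc (double k)) + U * u p (double k) ≡⟨ sym (u-+ p N (double k)) ⟩
        u p (suc (N + double k))                     ∎)
      where
      open ≡-Reasoning
      identity : ∀ p a z → z * (z + p * a) + 1 ≡ p * a * z + z * z + 1
      identity = solve-∀

    left-of-roots : ∀ a d H → 1 ≤ a → d + H ≡ B * a → a * a + d * d + U * U ≡ (A + B) * a * d →
                    ∃ λ k → a ≡ u p (suc (double k)) × A * a ≡ d + U * u p (suc (suc (double k)))
    left-of-roots a d H a≥1 d+H≡Ba eq =
      let w , H≡wU , norm = offset-divisible p U a H (below-smaller-root a d H d+H≡Ba eq)
          k , x≡ , a≡ = norm−1⇒consecutive (p * a + w) a (≤-trans (*-mono-≤ p≥1 a≥1) (m≤m+n _ w))
                          (trans (identity₁ p a w) (cong (p * (p * a + w) * a +_) norm))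
      in k , a≡ , (begin
        A * a                 ≡⟨ *-distribʳ-+ a (p * U) B ⟩
        p * U * a + B * a     ≡⟨ cong (p * U * a +_) (sym d+H≡Ba) ⟩
        p * U * a + (d + H)   ≡⟨ cong (λ t → p * U * a + (d + t)) H≡wU ⟩
        p * U * a + (d + w * U) ≡⟨ identity₂ p U a d w ⟩
        d + U * (p * a + w)   ≡⟨ cong (λ t → d + U * t) x≡ ⟩
        d + U * u p (suc (suc (double k))) ∎)
      where
      open ≡-Reasoning
      identity₁ : ∀ p a w → (p * a + w) * (p * a + w) + 1 ≡ p * (p * a + w) * a + (w * (w + p * a) + 1)
      identity₁ = solve-∀
      identity₂ : ∀ p U a d w → p * U * a + (d + w * U) ≡ d + U * (p * a + w)
      identity₂ = solve-∀

    partner-<N : ∀ k r d → k + r ≡ m →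
                    A * u p (suc (double k)) ≡ d + U * u p (suc (suc (double k))) → d ≡ u p (suc (double r))
    partner-<N k r d k+r≡m Aa≡ = +-cancelʳ-≡ (U * x) d (u p j) (begin
      d + U * x                   ≡⟨ sym Aa≡ ⟩
      A * u p (suc (double k))    ≡⟨ subst (λ i → u p (suc i) * u p (suc (double k)) ≡ u p i * x + u p j)
                                       indices (ocagne-odd p k j) ⟩
      U * x + u p j               ≡⟨ +-comm (U * x) (u p j) ⟩
      u p j + U * x               ∎)
      where
      open ≡-Reasoning
      x = u p (suc (suc (double k)))
      j = suc (double r)
      indices : suc (double k) + j ≡ N
      indices = trans (cong suc (+-suc (double k) (double r)))
                      (cong (λ t → suc (suc t)) (trans (sym (double-+ k r)) (cong double k+r≡m)))

    partner->N : ∀ t d → let k = suc m + t in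
                   A * u p (suc (double k)) ≡ d + U * u p (suc (suc (double k))) → d ≡ u p (suc (double t))
    partner->N t d Aa≡ = +-cancelʳ-≡ (U * x) d (u p j) (begin
      d + U * x       ≡⟨ sym Aa≡ ⟩
      A * a           ≡⟨ *-comm A a ⟩
      a * A           ≡⟨ sym (subst (λ i → u p (suc i) * U + u p j ≡ u p i * A) indices (ocagne-even p (suc m) j)) ⟩
      x * U + u p j   ≡⟨ trans (+-comm (x * U) (u p j)) (cong (u p j +_) (*-comm x U)) ⟩
      u p j + U * x   ∎)
      where
      open ≡-Reasoning
      a = u p (suc (double (suc m + t)))
      x = u p (suc (suc (double (suc m + t))))
      j = suc (double t)
      indices : N + j ≡ suc (double (suc m + t))
      indices = trans (+-suc N (double t)) (cong suc (sym (double-+ (suc m) t)))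

    Solution : ℕ → ℕ → Set
    Solution a d = (∃ λ k → a ≡ u p (suc (double k)) × d ≡ u p (suc (N + double k)))
                 ⊎ (∃ λ k → d ≡ u p (suc (double k)) × a ≡ u p (suc (N + double k)))
                 ⊎ (∃ λ k → ∃ λ r → k + r ≡ m × a ≡ u p (suc (double k)) × d ≡ u p (suc (double r)))

    private
      left-solution : ∀ a d H → 1 ≤ a → d + H ≡ B * a → a * a + d * d + U * U ≡ (A + B) * a * d → Solution a d
      left-solution a d H a≥1 d+H≡Ba eq = from-left (left-of-roots a d H a≥1 d+H≡Ba eq)
        where
        by-index : ∀ k → A * u p (suc (double k)) ≡ d + U * u p (suc (suc (double k))) →
                   Solution (u p (suc (double k))) d
        by-index k Aa≡ with k ≤? m
        ... | yes k≤m = let r , k+r≡m = m≤n⇒∃[o]m+o≡n k≤m in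
                        inj₂ (inj₂ (k , r , k+r≡m , refl , partner-<N k r d k+r≡m Aa≡))
        ... | no k≰m with m≤n⇒∃[o]m+o≡n (≰⇒> k≰m)
        ...   | t , refl = inj₂ (inj₁ (t , partner->N t d Aa≡ , cong (λ i → u p (suc i)) (double-+ (suc m) t)))
        from-left : (∃ λ k → a ≡ u p (suc (double k)) × A * a ≡ d + U * u p (suc (suc (double k)))) → Solution a d
        from-left (k , a≡ , Aa≡) =
          subst (λ a → Solution a d) (sym a≡) (by-index k (subst (λ a → A * a ≡ d + U * u p (suc (suc (double k)))) a≡ Aa≡))

      locate : ∀ a d → 1 ≤ a → a * a + d * d + U * U ≡ (A + B) * a * d → Solution a d
      locate a d a≥1 eq with A * a ≤? d | d ≤? B * a
      ... | yes Aa≤d | _ with m≤n⇒∃[o]m+o≡n Aa≤d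
      ...   | F , refl = inj₁ (right-of-roots a F eq)
      locate a d a≥1 eq | no _ | yes d≤Ba = let H , d+H≡Ba = m≤n⇒∃[o]m+o≡n d≤Ba in left-solution a d H a≥1 d+H≡Ba eq
      locate a d a≥1 eq | no Aa≰d | no d≰Ba = contradiction eq (no-root-between a d a≥1 (≰⇒> d≰Ba) (≰⇒> Aa≰d))

    solutions : ∀ a d → 1 ≤ a → a * a + d * d + U * U ≡ v p N * a * d → Solution a d
    solutions a d a≥1 eq = locate a d a≥1 (trans eq (cong (λ V → V * a * d) (v≡u+u p (suc (double m)))))

  -- Sums of squared divisors

  square-if-divides : ℕ → ℕ → ℕ
  square-if-divides n d with d ∣? n
  ... | yes _ = d * d
  ... | no _ = 0

  σ₂-upto : ℕ → ℕ → ℕ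
  σ₂-upto n zero = 0
  σ₂-upto n (suc k) = σ₂-upto n k + square-if-divides n (suc k)

  σ₂≡σ₂-upto : ∀ n → σ₂ n ≡ σ₂-upto n n
  σ₂≡σ₂-upto n = trans (sum-filter (map suc (upTo n))) (sum-upTo n)
    where
    sum-filter : ∀ ds → sum (map (λ d → d * d) (filter (_∣? n) ds)) ≡ sum (map (square-if-divides n) ds)
    sum-filter [] = refl
    sum-filter (d ∷ ds) with d ∣? n
    ... | yes _ = cong (d * d +_) (sum-filter ds)
    ... | no _ = sum-filter ds
    sum-upTo : ∀ k → sum (map (square-if-divides n) (map suc (upTo k))) ≡ σ₂-upto n k
    sum-upTo zero = refl
    sum-upTo (suc k) = begin
      sum (map g (map suc (upTo (suc k))))       ≡⟨ cong (λ ds → sum (map g (map suc ds))) (sym (upTo-∷ʳ k)) ⟩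
      sum (map g (map suc (upTo k ++ [ k ])))    ≡⟨ cong (λ ds → sum (map g ds)) (map-++ suc (upTo k) [ k ]) ⟩
      sum (map g (map suc (upTo k) ++ [ suc k ])) ≡⟨ cong sum (map-++ g (map suc (upTo k)) [ suc k ]) ⟩
      sum (map g (map suc (upTo k)) ++ [ g (suc k) ]) ≡⟨ sum-++ (map g (map suc (upTo k))) [ g (suc k) ] ⟩
      sum (map g (map suc (upTo k))) + (g (suc k) + 0) ≡⟨ cong₂ _+_ (sum-upTo k) (+-identityʳ _) ⟩
      σ₂-upto n k + g (suc k)                    ∎
      where
      open ≡-Reasoning
      g = square-if-divides n

  square-if-divides-∣ : ∀ {n d} → d ∣ n → square-if-divides n d ≡ d * d
  square-if-divides-∣ {n} {d} d∣n with d ∣? n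
  ... | yes _ = refl
  ... | no d∤n = contradiction d∣n d∤n

  square-if-divides-∤ : ∀ {n d} → ¬ d ∣ n → square-if-divides n d ≡ 0
  square-if-divides-∤ {n} {d} d∤n with d ∣? n
  ... | yes d∣n = contradiction d∣n d∤n
  ... | no _ = refl

  σ₂-upto-1 : ∀ n → σ₂-upto n 1 ≡ 1
  σ₂-upto-1 n = square-if-divides-∣ (1∣ n)

  σ₂-upto-mono : ∀ n {b k} → b ≤ k → σ₂-upto n b ≤ σ₂-upto n k
  σ₂-upto-mono n {k = zero} z≤n = ≤-refl
  σ₂-upto-mono n {b} {suc k} b≤k with m≤n⇒m<n∨m≡n b≤k
  ... | inj₂ refl = ≤-refl
  ... | inj₁ b<k = ≤-trans (σ₂-upto-mono n (≤-pred b<k)) (m≤m+n _ _)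

  σ₂-upto-gap : ∀ n {b k} → b ≤ k → (∀ e → b < e → e ≤ k → ¬ e ∣ n) → σ₂-upto n k ≡ σ₂-upto n b
  σ₂-upto-gap n {k = zero} z≤n _ = refl
  σ₂-upto-gap n {b} {suc k} b≤k gap with m≤n⇒m<n∨m≡n b≤k
  ... | inj₂ refl = refl
  ... | inj₁ b<k = trans (cong (σ₂-upto n k +_) (square-if-divides-∤ (gap (suc k) b<k ≤-refl)))
                  (trans (+-identityʳ _) (σ₂-upto-gap n (≤-pred b<k) (λ e b<e e≤k → gap e b<e (m≤n⇒m≤1+n e≤k))))

  σ₂-upto-next : ∀ n {b e} → b < e → e ∣ n → (∀ x → b < x → x < e → ¬ x ∣ n) →
                 σ₂-upto n e ≡ σ₂-upto n b + e * e
  σ₂-upto-next n {b} {suc e} b<e e∣n gap =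
    cong₂ _+_ (σ₂-upto-gap n (≤-pred b<e) (λ x b<x x≤e → gap x b<x (s≤s x≤e))) (square-if-divides-∣ e∣n)

  σ₂-upto-next-≥ : ∀ n {b e} → b < e → e ∣ n → σ₂-upto n b + e * e ≤ σ₂-upto n e
  σ₂-upto-next-≥ n {b} {suc e} b<e e∣n =
    +-mono-≤ (σ₂-upto-mono n (≤-pred b<e)) (≤-reflexive (sym (square-if-divides-∣ e∣n)))

  rough⇒∤ : ∀ {a n x} → a Rough n → 1 < x → x < a → ¬ x ∣ n
  rough⇒∤ rough 1<x x<a x∣n = rough (hasNonTrivialDivisor {{n>1⇒nonTrivial 1<x}} x<a x∣n)

  rough⇒≤ : ∀ {a n y} → a Rough n → 1 < y → y ∣ n → a ≤ y
  rough⇒≤ rough 1<y y∣n = ≮⇒≥ (λ y<a → rough⇒∤ rough 1<y y<a y∣n)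

  least-divisor : ∀ n → 2 ≤ n → ∃ λ a → 2 ≤ a × a ∣ n × a Rough n
  least-divisor n n≥2 = search 2 (n ∸ 2) (m+[n∸m]≡n n≥2) ≤-refl 2-rough
    where
    search : ∀ k f → k + f ≡ n → 2 ≤ k → k Rough n → ∃ λ a → 2 ≤ a × a ∣ n × a Rough n
    search k f k+f≡n k≥2 rough with k ∣? n
    search k f k+f≡n k≥2 rough | yes k∣n = k , k≥2 , k∣n , rough
    search k zero k+0≡n k≥2 rough | no k∤n =
      contradiction (subst (k ∣_) (trans (sym (+-identityʳ k)) k+0≡n) ∣-refl) k∤n
    search k (suc f) k+f≡n k≥2 rough | no k∤n =
      search (suc k) f (trans (sym (+-suc k f)) k+f≡n) (m≤n⇒m≤1+n k≥2) (∤⇒rough-suc k∤n rough)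

  cofactor>1 : ∀ {n x y} → n ≡ y * x → x < n → 1 < y
  cofactor>1 {y = zero} refl ()
  cofactor>1 {x = x} {y = suc zero} refl x<n = contradiction x<n (<-irrefl (sym (+-identityʳ x)))
  cofactor>1 {y = suc (suc y)} _ _ = s≤s (s≤s z≤n)

  σ₂-prime : ∀ {q} → 2 ≤ q → q Rough q → σ₂ q ≡ 1 + q * q
  σ₂-prime {q} q≥2 rough = begin
    σ₂ q                   ≡⟨ σ₂≡σ₂-upto q ⟩
    σ₂-upto q q            ≡⟨ σ₂-upto-next q q≥2 ∣-refl (λ _ → rough⇒∤ rough) ⟩
    σ₂-upto q 1 + q * q    ≡⟨ cong (_+ q * q) (σ₂-upto-1 q) ⟩
    1 + q * q              ∎
    where open ≡-Reasoning

  σ₂-square : ∀ {a} → 2 ≤ a → a Rough (a * a) → σ₂ (a * a) ≡ 1 + a * a + a * a * (a * a)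
  σ₂-square {a} a≥2 rough = begin
    σ₂ n                        ≡⟨ σ₂≡σ₂-upto n ⟩
    σ₂-upto n n                 ≡⟨ σ₂-upto-next n a<n ∣-refl no-divisor-above-a ⟩
    σ₂-upto n a + n * n         ≡⟨ cong (_+ n * n) (σ₂-upto-next n a≥2 (divides a refl) (λ _ → rough⇒∤ rough)) ⟩
    σ₂-upto n 1 + a * a + n * n ≡⟨ cong (λ t → t + a * a + n * n) (σ₂-upto-1 n) ⟩
    1 + a * a + n * n           ∎
    where
    open ≡-Reasoning
    n = a * a
    instance
      a≢0 : NonZero a
      a≢0 = >-nonZero (≤-trans (s≤s z≤n) a≥2)
    a<n : a < n
    a<n = m<m*n a a a≥2
    no-divisor-above-a : ∀ x → a < x → x < n → ¬ x ∣ n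
    no-divisor-above-a x a<x x<n (divides y n≡yx) = <-irrefl n≡yx
      (<-≤-trans (*-monoʳ-< a a<x)
                 (*-monoˡ-≤ x (rough⇒≤ rough (cofactor>1 n≡yx x<n) (divides x (trans n≡yx (*-comm y x))))))

  proper-divisor-of-semiprime : ∀ {a d x} → Prime a → Prime d → a < x → x < d * a → x ∣ d * a → x ≡ d
  proper-divisor-of-semiprime {a} {d} {x} pa pd a<x x<n (divides y n≡yx)
    with euclidsLemma y x pa (divides d (sym n≡yx))
  ... | inj₁ (divides h y≡ha) with prime⇒irreducible pd (divides h d≡hx)
    where
    instance _ = prime⇒nonZero pa
    d≡hx : d ≡ h * x
    d≡hx = *-cancelʳ-≡ d (h * x) a (trans n≡yx (trans (cong (_* x) y≡ha) (identity h a x)))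
      where
      identity : ∀ h a x → h * a * x ≡ h * x * a
      identity = solve-∀
  ...   | inj₁ x≡1 = contradiction (subst (a <_) x≡1 a<x) (≤⇒≯ (>-nonZero⁻¹ a {{prime⇒nonZero pa}}))
  ...   | inj₂ x≡d = x≡d
  proper-divisor-of-semiprime {a} {d} {x} pa pd a<x x<n (divides y n≡yx)
    | inj₂ (divides g x≡ga) with prime⇒irreducible pd (divides y d≡yg)
    where
    instance _ = prime⇒nonZero pa
    d≡yg : d ≡ y * g
    d≡yg = *-cancelʳ-≡ d (y * g) a (trans n≡yx (trans (cong (y *_) x≡ga) (sym (*-assoc y g a))))
  ...   | inj₁ refl = contradiction a<x (<-irrefl (sym (trans x≡ga (+-identityʳ a))))
  ...   | inj₂ refl = contradiction x<n (<-irrefl x≡ga)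

  σ₂-semiprime : ∀ {a d} → a < d → a Rough (d * a) → Prime a → Prime d →
                 σ₂ (d * a) ≡ 1 + (a * a + d * d) + d * a * (d * a)
  σ₂-semiprime {a} {d} a<d rough pa pd = begin
    σ₂ n                                ≡⟨ σ₂≡σ₂-upto n ⟩
    σ₂-upto n n                         ≡⟨ σ₂-upto-next n d<n ∣-refl (λ x d<x x<n x∣n →
                                             <-irrefl (sym (only-d x (<-trans a<d d<x) x<n x∣n)) d<x) ⟩
    σ₂-upto n d + n * n                 ≡⟨ cong (_+ n * n) (σ₂-upto-next n a<d (divides a (*-comm d a)) (λ x a<x x<d x∣n →
                                             <-irrefl (only-d x a<x (<-trans x<d d<n) x∣n) x<d)) ⟩
    σ₂-upto n a + d * d + n * n         ≡⟨ cong (λ t → t + d * d + n * n)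
                                             (σ₂-upto-next n a≥2 (divides d refl) (λ _ → rough⇒∤ rough)) ⟩
    σ₂-upto n 1 + a * a + d * d + n * n ≡⟨ cong (λ t → t + a * a + d * d + n * n) (σ₂-upto-1 n) ⟩
    1 + a * a + d * d + n * n           ≡⟨ cong (_+ n * n) (+-assoc 1 (a * a) (d * d)) ⟩
    1 + (a * a + d * d) + n * n         ∎
    where
    open ≡-Reasoning
    n = d * a
    instance
      d≢0 = prime⇒nonZero pd
    a≥2 : 2 ≤ a
    a≥2 = nonTrivial⇒n>1 a {{prime⇒nonTrivial pa}}
    d<n : d < n
    d<n = m<m*n d a a≥2
    only-d : ∀ x → a < x → x < n → x ∣ n → x ≡ d
    only-d x = proper-divisor-of-semiprime pa pd

  σ₂-≥ : ∀ {n a d} → 1 < a → a < d → d < n → a ∣ n → d ∣ n → 1 + (a * a + d * d) + n * n ≤ σ₂ n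
  σ₂-≥ {n} {a} {d} 1<a a<d d<n a∣n d∣n = begin
    1 + (a * a + d * d) + n * n          ≡⟨ cong (_+ n * n) (sym (+-assoc 1 (a * a) (d * d))) ⟩
    1 + a * a + d * d + n * n            ≡⟨ cong (λ t → t + a * a + d * d + n * n) (sym (σ₂-upto-1 n)) ⟩
    σ₂-upto n 1 + a * a + d * d + n * n  ≤⟨ +-monoˡ-≤ (n * n) (+-monoˡ-≤ (d * d) (σ₂-upto-next-≥ n 1<a a∣n)) ⟩
    σ₂-upto n a + d * d + n * n          ≤⟨ +-monoˡ-≤ (n * n) (σ₂-upto-next-≥ n a<d d∣n) ⟩
    σ₂-upto n d + n * n                  ≤⟨ σ₂-upto-next-≥ n d<n ∣-refl ⟩
    σ₂-upto n n                          ≡⟨ sym (σ₂≡σ₂-upto n) ⟩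
    σ₂ n                                 ∎
    where open ≤-Reasoning

  cofactor-cases : ∀ {n a d} → 2 ≤ a → a Rough n → n ≡ d * a → 2 ≤ d →
                   a ≡ d ⊎ (a < d × Prime d) ⊎ a * a ≤ d
  cofactor-cases {n} {a} {d} a≥2 rough n≡da d≥2 = by-least-divisor (least-divisor d d≥2)
    where
    a≤d : a ≤ d
    a≤d = rough⇒≤ rough d≥2 (divides a (trans n≡da (*-comm d a)))
    by-least-divisor : (∃ λ b → 2 ≤ b × b ∣ d × b Rough d) → a ≡ d ⊎ (a < d × Prime d) ⊎ a * a ≤ d
    by-least-divisor (b , b≥2 , divides c d≡cb , rough-d)
      with m≤n⇒m<n∨m≡n (∣⇒≤ {{>-nonZero (≤-trans (s≤s z≤n) d≥2)}} (divides c d≡cb)) | m≤n⇒m<n∨m≡n a≤d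
    ... | inj₂ refl | inj₂ a≡d = inj₁ a≡d
    ... | inj₂ refl | inj₁ a<d = inj₂ (inj₁ (a<d , rough∧∣⇒prime {{n>1⇒nonTrivial b≥2}} rough-d ∣-refl))
    ... | inj₁ b<d | _ = inj₂ (inj₂ (begin
      a * a   ≤⟨ *-mono-≤ (rough⇒≤ rough (cofactor>1 d≡cb b<d) (divides (b * a) (n≡ c b d≡cb)))
                          (rough⇒≤ rough b≥2 (divides (c * a) (n≡ b c (trans d≡cb (*-comm c b))))) ⟩
      c * b   ≡⟨ sym d≡cb ⟩
      d       ∎))
      where
      open ≤-Reasoning
      n≡ : ∀ x y → d ≡ x * y → n ≡ y * a * x
      n≡ x y d≡xy = trans n≡da (trans (cong (_* a) d≡xy) (identity x y a))
        where
        identity : ∀ x y a → x * y * a ≡ y * a * x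
        identity = solve-∀

  Equation : ℕ → ℕ → ℕ → Set
  Equation n U V = σ₂ n + U * U ≡ n * n + V * n + 1

  equation-residue : ∀ n s U V → σ₂ n ≡ 1 + s + n * n → Equation n U V → s + U * U ≡ V * n
  equation-residue n s U V σ₂≡ eq = +-cancelˡ-≡ (n * n + 1) _ _ (begin
    n * n + 1 + (s + U * U)  ≡⟨ identity₁ n s U ⟩
    1 + s + n * n + U * U    ≡⟨ cong (_+ U * U) (sym σ₂≡) ⟩
    σ₂ n + U * U             ≡⟨ eq ⟩
    n * n + V * n + 1        ≡⟨ identity₂ n V ⟩
    n * n + 1 + V * n        ∎)
    where
    open ≡-Reasoning
    identity₁ : ∀ n s U → n * n + 1 + (s + U * U) ≡ 1 + s + n * n + U * U
    identity₁ = solve-∀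
    identity₂ : ∀ n V → n * n + V * n + 1 ≡ n * n + 1 + V * n
    identity₂ = solve-∀

  equation-residue-≤ : ∀ n s U V → 1 + s + n * n ≤ σ₂ n → Equation n U V → s + U * U ≤ V * n
  equation-residue-≤ n s U V σ₂≥ eq = +-cancelˡ-≤ (n * n + 1) _ _ (begin
    n * n + 1 + (s + U * U)  ≡⟨ identity₁ n s U ⟩
    1 + s + n * n + U * U    ≤⟨ +-monoˡ-≤ (U * U) σ₂≥ ⟩
    σ₂ n + U * U             ≡⟨ eq ⟩
    n * n + V * n + 1        ≡⟨ identity₂ n V ⟩
    n * n + 1 + V * n        ∎)
    where
    open ≤-Reasoning
    identity₁ : ∀ n s U → n * n + 1 + (s + U * U) ≡ 1 + s + n * n + U * U
    identity₁ = solve-∀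
    identity₂ : ∀ n V → n * n + V * n + 1 ≡ n * n + 1 + V * n
    identity₂ = solve-∀

  n≤n^3 : ∀ n → n ≤ n ^ 3
  n≤n^3 zero = z≤n
  n≤n^3 n@(suc _) = m≤m*n n (n ^ 2) {{m^n≢0 n 2}}

  ≤-bound : ∀ U V {x} → x ≤ V + U * U ∸ 1 → x ≤ (V + U * U ∸ 1) ^ 3
  ≤-bound U V x≤ = ≤-trans x≤ (n≤n^3 _)

  U²≤bound : ∀ U V → 1 ≤ V → U * U ≤ V + U * U ∸ 1
  U²≤bound U (suc V) _ = m≤n+m (U * U) V

  V≤bound : ∀ U V → 1 ≤ U * U → V ≤ V + U * U ∸ 1
  V≤bound U V U²≥1 = ≤-trans (m≤m+n V (U * U ∸ 1)) (≤-reflexive (sym (+-∸-assoc V U²≥1)))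

  a²+d²≰2ad : ∀ {a d} → a < d → ¬ (a * a + d * d ≤ 2 * a * d)
  a²+d²≰2ad {a} {d} a<d with m≤n⇒∃[o]m+o≡n a<d
  ... | t , refl = λ le → contradiction (+-cancelˡ-≤ (2 * a * suc (a + t)) _ 0
          (≤-trans (≤-reflexive (sym (identity a t))) (≤-trans le (≤-reflexive (sym (+-identityʳ _)))))) λ ()
    where
    identity : ∀ a t → a * a + suc (a + t) * suc (a + t) ≡ 2 * a * suc (a + t) + suc t * suc t
    identity = solve-∀

  prime-solution-bounded : ∀ U V {q} → 2 ≤ q → q Rough q → 1 ≤ V → Equation q U V → q ≤ U * U
  prime-solution-bounded U V {q} q≥2 rough V≥1 eq =
    ≤-trans (m≤n*m q V {{>-nonZero V≥1}}) (≤-reflexive (sym (equation-residue q 0 U V (σ₂-prime q≥2 rough) eq)))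

  square-solution-bounded : ∀ U V {a} → 2 ≤ a → a Rough (a * a) → 2 ≤ V → Equation (a * a) U V → a * a ≤ U * U
  square-solution-bounded U V {a} a≥2 rough V≥2 eq = +-cancelˡ-≤ (a * a) _ _ (begin
    a * a + a * a    ≡⟨ cong (a * a +_) (sym (+-identityʳ (a * a))) ⟩
    2 * (a * a)      ≤⟨ *-monoˡ-≤ (a * a) V≥2 ⟩
    V * (a * a)      ≡⟨ sym (equation-residue (a * a) (a * a) U V (σ₂-square a≥2 rough) eq) ⟩
    a * a + U * U    ∎)
    where open ≤-Reasoning

  semiprime-solution : ∀ U V {a d} → a < d → a Rough (d * a) → Prime a → Prime d → Equation (d * a) U V →
                       a * a + d * d + U * U ≡ V * a * d
  semiprime-solution U V {a} {d} a<d rough pa pd eq =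
    trans (equation-residue (d * a) (a * a + d * d) U V (σ₂-semiprime a<d rough pa pd) eq) (identity V d a)
    where
    identity : ∀ V d a → V * (d * a) ≡ V * a * d
    identity = solve-∀

  -- σ₂(n) ≥ 1 + a² + d² + n² gives a² + d² + U² ≤ V a d, hence d ≤ V a and a ≤ V when U ≠ 0.
  large-cofactor-bounded : ∀ U V {n a d} → 2 ≤ a → a * a ≤ d → n ≡ d * a → (U ≡ 0 → V ≡ 2) →
                           Equation n U V → n ≤ (V + U * U ∸ 1) ^ 3
  large-cofactor-bounded U V {n} {a} {d} a≥2 a²≤d n≡da U≡0⇒V≡2 eq = by-cases (U ≟ 0)
    where
    instance
      a≢0 : NonZero a
      a≢0 = >-nonZero (≤-trans (s≤s z≤n) a≥2)
    a<d : a < d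
    a<d = <-≤-trans (m<m*n a a a≥2) a²≤d
    instance
      d≢0 : NonZero d
      d≢0 = >-nonZero (≤-trans (s≤s z≤n) a<d)
    a²+d²+U²≤Vad : a * a + d * d + U * U ≤ V * a * d
    a²+d²+U²≤Vad = ≤-trans
      (equation-residue-≤ n (a * a + d * d) U V (σ₂-≥ a≥2 a<d d<n (divides d n≡da) (divides a (trans n≡da (*-comm d a)))) eq)
      (≤-reflexive (trans (cong (V *_) n≡da) (identity V d a)))
      where
      d<n : d < n
      d<n = subst (d <_) (sym n≡da) (m<m*n d a a≥2)
      identity : ∀ V d a → V * (d * a) ≡ V * a * d
      identity = solve-∀
    by-cases : Dec (U ≡ 0) → n ≤ (V + U * U ∸ 1) ^ 3
    by-cases (yes U≡0) = contradiction
      (≤-trans (≤-reflexive (sym (+-identityʳ _)))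
               (subst₂ (λ x y → a * a + d * d + x * x ≤ y * a * d) U≡0 (U≡0⇒V≡2 U≡0) a²+d²+U²≤Vad))
      (a²+d²≰2ad a<d)
    by-cases (no U≢0) = begin
      n            ≡⟨ n≡da ⟩
      d * a        ≤⟨ *-monoˡ-≤ a d≤Va ⟩
      V * a * a    ≤⟨ *-mono-≤ (*-monoʳ-≤ V a≤V) a≤V ⟩
      V * V * V    ≡⟨ identity V ⟩
      V ^ 3        ≤⟨ ^-monoˡ-≤ 3 (V≤bound U V (*-mono-≤ (n≢0⇒n>0 U≢0) (n≢0⇒n>0 U≢0))) ⟩
      (V + U * U ∸ 1) ^ 3 ∎
      where
      open ≤-Reasoning
      d≤Va : d ≤ V * a
      d≤Va = *-cancelʳ-≤ d (V * a) d (≤-trans (≤-trans (m≤n+m (d * d) (a * a)) (m≤m+n _ (U * U))) a²+d²+U²≤Vad)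
      a≤V : a ≤ V
      a≤V = *-cancelʳ-≤ a V a (≤-trans a²≤d d≤Va)
      identity : ∀ V → V * V * V ≡ V * (V * (V * 1))
      identity = solve-∀

  PrimePairSolution : ℕ → ℕ → ℕ → Set
  PrimePairSolution n U V = ∃ λ a → ∃ λ d → a < d × Prime a × Prime d × n ≡ d * a × a * a + d * d + U * U ≡ V * a * d

  σ₂-equation-cases : ∀ n U V → 1 ≤ n → 2 ≤ V → (U ≡ 0 → V ≡ 2) → Equation n U V →
                      n ≤ (V + U * U ∸ 1) ^ 3 ⊎ PrimePairSolution n U V
  σ₂-equation-cases (suc zero) U V _ V≥2 _ _ =
    inj₁ (≤-bound U V (≤-trans (∸-monoˡ-≤ 1 V≥2) (∸-monoˡ-≤ 1 (m≤m+n V (U * U)))))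
  σ₂-equation-cases n@(suc (suc _)) U V _ V≥2 U≡0⇒V≡2 eq with least-divisor n (s≤s (s≤s z≤n))
  ... | a , a≥2 , divides d n≡da , rough = by-cofactor d n≡da
    where
    V≥1 = ≤-trans (s≤s z≤n) V≥2
    bounded-by-U² : ∀ {x} → x ≤ U * U → x ≤ (V + U * U ∸ 1) ^ 3
    bounded-by-U² x≤U² = ≤-bound U V (≤-trans x≤U² (U²≤bound U V V≥1))
    by-cofactor : ∀ d → n ≡ d * a → n ≤ (V + U * U ∸ 1) ^ 3 ⊎ PrimePairSolution n U V
    by-cofactor (suc zero) n≡1*a = inj₁ (bounded-by-U²
      (prime-solution-bounded U V (s≤s (s≤s z≤n)) (subst (_Rough n) (sym n≡a) rough) V≥1 eq))
      where
      n≡a : n ≡ a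
      n≡a = trans n≡1*a (+-identityʳ a)
    by-cofactor d@(suc (suc _)) n≡da with cofactor-cases a≥2 rough n≡da (s≤s (s≤s z≤n))
    ... | inj₁ a≡d = inj₁ (subst (_≤ (V + U * U ∸ 1) ^ 3) (sym n≡aa) (bounded-by-U²
      (square-solution-bounded U V a≥2 (subst (a Rough_) n≡aa rough) V≥2 (subst (λ n → Equation n U V) n≡aa eq))))
      where
      n≡aa : n ≡ a * a
      n≡aa = trans n≡da (cong (_* a) (sym a≡d))
    ... | inj₂ (inj₁ (a<d , prime-d)) = inj₂ (a , d , a<d , prime-a , prime-d , n≡da ,
      semiprime-solution U V a<d (subst (a Rough_) n≡da rough) prime-a prime-d (subst (λ n → Equation n U V) n≡da eq))
      where
      prime-a : Prime a
      prime-a = rough∧∣⇒prime {{n>1⇒nonTrivial a≥2}} rough (divides d n≡da)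
    ... | inj₂ (inj₂ a²≤d) = inj₁ (large-cofactor-bounded U V a≥2 a²≤d n≡da U≡0⇒V≡2 eq)

  Classification : ℕ → ℕ → ℕ → Set
  Classification p m n =
      n ≤ (v p (double m) + u p (double m) * u p (double m) ∸ 1) ^ 3
    ⊎ (∃ λ k → n ≡ u p (suc (double k)) * u p (suc (double (m + k)))
               × Prime (u p (suc (double k))) × Prime (u p (suc (double (m + k)))))
    ⊎ (∃ λ k → ∃ λ r → suc (k + r) ≡ m × k ≢ r × n ≡ u p (suc (double k)) * u p (suc (double r))
               × Prime (u p (suc (double k))) × Prime (u p (suc (double r))))

  no-prime-pair-if-U≡0 : ∀ p m {a d} → u p (double m) ≡ 0 → a < d →
    a * a + d * d + u p (double m) * u p (double m) ≢ v p (double m) * a * d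
  no-prime-pair-if-U≡0 p m {a} {d} U≡0 a<d quad = a²+d²≰2ad a<d (≤-reflexive (begin
    a * a + d * d                  ≡⟨ sym (+-identityʳ _) ⟩
    a * a + d * d + 0 * 0          ≡⟨ cong (λ x → a * a + d * d + x * x) (sym U≡0) ⟩
    a * a + d * d + U * U          ≡⟨ quad ⟩
    v p (double m) * a * d         ≡⟨ cong (λ x → x * a * d) (u-even≡0⇒v-even≡2 p m U≡0) ⟩
    2 * a * d                      ∎))
    where
    open ≡-Reasoning
    U = u p (double m)

  prime-pair-classification : ∀ p m {n a d} → a < d → Prime a → Prime d → n ≡ d * a →
    a * a + d * d + u p (double m) * u p (double m) ≡ v p (double m) * a * d → Classification p m n
  prime-pair-classification (suc p) (suc m) {n} {a} {d} a<d pa pd n≡da quad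
    with Solutions.solutions (suc p) m (s≤s z≤n) a d (>-nonZero⁻¹ a {{prime⇒nonZero pa}}) quad
  ... | inj₁ (k , refl , refl) =
    inj₂ (inj₁ (k , trans n≡da (trans (*-comm d a) (cong (a *_) ud≡)) , pa , subst Prime ud≡ pd))
    where
    ud≡ : d ≡ u (suc p) (suc (double (suc m + k)))
    ud≡ = cong (λ i → u (suc p) (suc i)) (sym (double-+ (suc m) k))
  ... | inj₂ (inj₁ (k , refl , refl)) =
    inj₂ (inj₁ (k , trans n≡da (cong (d *_) ua≡) , pd , subst Prime ua≡ pa))
    where
    ua≡ : a ≡ u (suc p) (suc (double (suc m + k)))
    ua≡ = cong (λ i → u (suc p) (suc i)) (sym (double-+ (suc m) k))
  ... | inj₂ (inj₂ (k , r , k+r≡m , refl , refl)) =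
    inj₂ (inj₂ (k , r , cong suc k+r≡m , k≢r , trans n≡da (*-comm d a) , pa , pd))
    where
    k≢r : k ≢ r
    k≢r k≡r = <-irrefl (cong (λ i → u (suc p) (suc (double i))) k≡r) a<d
  prime-pair-classification p zero a<d _ _ _ quad = contradiction quad (no-prime-pair-if-U≡0 p zero refl a<d)
  prime-pair-classification zero (suc m) a<d _ _ _ quad =
    contradiction quad (no-prime-pair-if-U≡0 zero (suc m) (u[0]-even (suc m)) a<d)

  classification : ∀ p m n → 1 ≤ n → Equation n (u p (double m)) (v p (double m)) → Classification p m n
  classification p m n n≥1 eq
    with σ₂-equation-cases n (u p (double m)) (v p (double m)) n≥1 (v-even≥2 p m) (u-even≡0⇒v-even≡2 p m) eq
  ... | inj₁ bounded = inj₁ bounded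
  ... | inj₂ (a , d , a<d , pa , pd , n≡da , quad) = prime-pair-classification p m a<d pa pd n≡da quad

open import Defs
open import Data.Nat using (ℕ; zero; suc; _≤_; _^_)
import Data.Nat as ℕ
import Data.Nat.Properties as ℕ
open import Data.Nat.Primality using (Prime)
open import Data.Nat.Tactic.RingSolver using (solve-∀)
open import Data.Integer using (ℤ; +_; -_; -[1+_]; _+_; _-_; _*_; ∣_∣)
open import Data.Integer.Properties using (pos-+; pos-*; ∣-i∣≡∣i∣; +-injective)
import Data.Integer.Tactic.RingSolver as ℤ
open import Data.Product using (Σ; ∃; _×_; _,_; proj₁)
open import Data.Sum using (_⊎_)
import Data.Sum as Sum
open import Function using (_∘_)
open import Relation.Binary.PropositionalEquality
open Arithmetic

-- Back to the integer sequences U_n(P,-1) and V_n(P,-1)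

pos-*-+ : ∀ p b a → + p * + b + + a ≡ + (p ℕ.* b ℕ.+ a)
pos-*-+ p b a = sym (trans (pos-+ (p ℕ.* b) a) (cong (_+ + a) (pos-* p b)))

lucas-step-pos : ∀ p b a → + p * + b - (- + 1) * + a ≡ + (p ℕ.* b ℕ.+ a)
lucas-step-pos p b a = trans (identity (+ p) (+ b) (+ a)) (pos-*-+ p b a)
  where
  identity : ∀ p b a → p * b - (- + 1) * a ≡ p * b + a
  identity = ℤ.solve-∀

lucas-step-neg-pos : ∀ p b a → (- + p) * + b - (- + 1) * (- + a) ≡ - + (p ℕ.* b ℕ.+ a)
lucas-step-neg-pos p b a = trans (identity (+ p) (+ b) (+ a)) (cong -_ (pos-*-+ p b a))
  where
  identity : ∀ p b a → (- p) * b - (- + 1) * (- a) ≡ - (p * b + a)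
  identity = ℤ.solve-∀

lucas-step-neg-neg : ∀ p b a → (- + p) * (- + b) - (- + 1) * + a ≡ + (p ℕ.* b ℕ.+ a)
lucas-step-neg-neg p b a = trans (identity (+ p) (+ b) (+ a)) (pos-*-+ p b a)
  where
  identity : ∀ p b a → (- p) * (- b) - (- + 1) * a ≡ p * b + a
  identity = ℤ.solve-∀

Upair-pos : ∀ p n → Upair (+ p) (- + 1) n ≡ (+ u p n , + u p (suc n))
Upair-pos p zero = refl
Upair-pos p (suc n) rewrite Upair-pos p n = cong (+ u p (suc n) ,_) (lucas-step-pos p _ _)

Vpair-pos : ∀ p n → Vpair (+ p) (- + 1) n ≡ (+ v p n , + v p (suc n))
Vpair-pos p zero = refl
Vpair-pos p (suc n) rewrite Vpair-pos p n = cong (+ v p (suc n) ,_) (lucas-step-pos p _ _)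

Upair-neg : ∀ p i → Upair (- + p) (- + 1) (double i) ≡ (- + u p (double i) , + u p (suc (double i)))
Upair-neg p zero = refl
Upair-neg p (suc i) rewrite Upair-neg p i | lucas-step-neg-pos p (u p (suc (double i))) (u p (double i)) =
  cong (- + u p (suc (suc (double i))) ,_) (lucas-step-neg-neg p _ _)

Vpair-neg : ∀ p i → Vpair (- + p) (- + 1) (double i) ≡ (+ v p (double i) , - + v p (suc (double i)))
Vpair-neg p zero = refl
Vpair-neg p (suc i) rewrite Vpair-neg p i | lucas-step-neg-neg p (v p (suc (double i))) (v p (double i)) =
  cong (+ v p (suc (suc (double i))) ,_) (lucas-step-neg-pos p _ _)

U-odd : ∀ P i → U P (- + 1) (suc (double i)) ≡ + u (∣ P ∣) (suc (double i))
U-odd (+ p) i = cong proj₁ (Upair-pos p (suc (double i)))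
U-odd -[1+ q ] i rewrite Upair-neg (suc q) i = refl

∣U-even∣ : ∀ P i → ∣ U P (- + 1) (double i) ∣ ≡ u (∣ P ∣) (double i)
∣U-even∣ (+ p) i = cong (∣_∣ ∘ proj₁) (Upair-pos p (double i))
∣U-even∣ -[1+ q ] i = trans (cong (∣_∣ ∘ proj₁) (Upair-neg (suc q) i)) (∣-i∣≡∣i∣ (+ u (suc q) (double i)))

V-even : ∀ P i → V P (- + 1) (double i) ≡ + v (∣ P ∣) (double i)
V-even (+ p) i = cong proj₁ (Vpair-pos p (double i))
V-even -[1+ q ] i = cong proj₁ (Vpair-neg (suc q) i)

i*i≡+∣i∣*∣i∣ : ∀ i → i * i ≡ + (∣ i ∣ ℕ.* ∣ i ∣)
i*i≡+∣i∣*∣i∣ (+ n) = sym (pos-* n n)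
i*i≡+∣i∣*∣i∣ -[1+ n ] = refl

ℤ-equation⇒ℕ : ∀ n s w V → + s - + n * + n ≡ + V * + n - + w + + 1 → s ℕ.+ w ≡ n ℕ.* n ℕ.+ V ℕ.* n ℕ.+ 1
ℤ-equation⇒ℕ n s w V eq = +-injective (begin
  + (s ℕ.+ w)                       ≡⟨ pos-+ s w ⟩
  + s + + w                         ≡⟨ identity₁ (+ s) (+ n * + n) (+ w) ⟩
  (+ s - + n * + n) + (+ n * + n + + w) ≡⟨ cong (_+ (+ n * + n + + w)) eq ⟩
  (+ V * + n - + w + + 1) + (+ n * + n + + w) ≡⟨ identity₂ (+ V * + n) (+ w) (+ n * + n) ⟩
  + n * + n + + V * + n + + 1       ≡⟨ sym (cong (_+ + 1) (cong₂ _+_ (pos-* n n) (pos-* V n))) ⟩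
  + (n ℕ.* n) + + (V ℕ.* n) + + 1   ≡⟨ sym (trans (pos-+ (n ℕ.* n ℕ.+ V ℕ.* n) 1)
                                               (cong (_+ + 1) (pos-+ (n ℕ.* n) (V ℕ.* n)))) ⟩
  + (n ℕ.* n ℕ.+ V ℕ.* n ℕ.+ 1)    ∎)
  where
  open ≡-Reasoning
  identity₁ : ∀ s nn w → s + w ≡ (s - nn) + (nn + w)
  identity₁ = ℤ.solve-∀
  identity₂ : ∀ Vn w nn → (Vn - w + + 1) + (nn + w) ≡ nn + Vn + + 1
  identity₂ = ℤ.solve-∀

PrimeProduct : ℤ → ℕ → ℕ → ℕ → Set
PrimeProduct P n e f = (+ n ≡ U P (- + 1) e * U P (- + 1) f) × IsPrimeℤ (U P (- + 1) e) × IsPrimeℤ (U P (- + 1) f)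

odd-prime-product : ∀ P n {e f} i j → e ≡ suc (double i) → f ≡ suc (double j) →
  n ≡ u (∣ P ∣) (suc (double i)) ℕ.* u (∣ P ∣) (suc (double j)) →
  Prime (u (∣ P ∣) (suc (double i))) → Prime (u (∣ P ∣) (suc (double j))) → PrimeProduct P n e f
odd-prime-product P n i j refl refl n≡ prime-e prime-f =
  trans (cong +_ n≡) (trans (pos-* (u (∣ P ∣) (suc (double i))) _) (sym (cong₂ _*_ (U-odd P i) (U-odd P j)))) ,
  (_ , prime-e , U-odd P i) , (_ , prime-f , U-odd P j)

2k+1≡ : ∀ k → 2 ℕ.* k ℕ.+ 1 ≡ suc (double k)
2k+1≡ k = trans (ℕ.+-comm (2 ℕ.* k) 1) (cong suc (sym (double≡2* k)))

2k+2m+1≡ : ∀ k m → 2 ℕ.* k ℕ.+ 2 ℕ.* m ℕ.+ 1 ≡ suc (double (m ℕ.+ k))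
2k+2m+1≡ k m = trans (identity k m) (cong suc (sym (double≡2* (m ℕ.+ k))))
  where
  identity : ∀ k m → 2 ℕ.* k ℕ.+ 2 ℕ.* m ℕ.+ 1 ≡ 1 ℕ.+ 2 ℕ.* (m ℕ.+ k)
  identity = solve-∀

2[1+k+r]≡ : ∀ k r → 2 ℕ.* suc (k ℕ.+ r) ≡ (2 ℕ.* k ℕ.+ 1) ℕ.+ suc (double r)
2[1+k+r]≡ k r = trans (identity k r) (cong (λ x → 2 ℕ.* k ℕ.+ 1 ℕ.+ suc x) (sym (double≡2* r)))
  where
  identity : ∀ k r → 2 ℕ.* (1 ℕ.+ (k ℕ.+ r)) ≡ (2 ℕ.* k ℕ.+ 1) ℕ.+ (1 ℕ.+ 2 ℕ.* r)
  identity = solve-∀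

natural-equation : ∀ P m n →
  + (σ₂ n) - + n * + n ≡ V P (- + 1) (2 ℕ.* m) * + n - U P (- + 1) (2 ℕ.* m) * U P (- + 1) (2 ℕ.* m) + + 1 →
  Equation n (u (∣ P ∣) (double m)) (v (∣ P ∣) (double m))
natural-equation P m n eq =
  ℤ-equation⇒ℕ n (σ₂ n) (u (∣ P ∣) (double m) ℕ.* u (∣ P ∣) (double m)) (v (∣ P ∣) (double m)) (begin
  + σ₂ n - + n * + n                                              ≡⟨ eq′ ⟩
  V P (- + 1) (double m) * + n - U² + + 1                         ≡⟨ cong₂ (λ x y → x * + n - y + + 1) (V-even P m) U²≡ ⟩
  + v (∣ P ∣) (double m) * + n - + (u (∣ P ∣) (double m) ℕ.* u (∣ P ∣) (double m)) + + 1 ∎)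
  where
  open ≡-Reasoning
  U² = U P (- + 1) (double m) * U P (- + 1) (double m)
  eq′ : + σ₂ n - + n * + n ≡ V P (- + 1) (double m) * + n - U² + + 1
  eq′ = subst (λ j → + σ₂ n - + n * + n ≡ V P (- + 1) j * + n - U P (- + 1) j * U P (- + 1) j + + 1)
              (sym (double≡2* m)) eq
  U²≡ : U² ≡ + (u (∣ P ∣) (double m) ℕ.* u (∣ P ∣) (double m))
  U²≡ = trans (i*i≡+∣i∣*∣i∣ (U P (- + 1) (double m))) (cong (λ x → + (x ℕ.* x)) (∣U-even∣ P m))

lift-bound : ∀ P m n → n ≤ (v (∣ P ∣) (double m) ℕ.+ u (∣ P ∣) (double m) ℕ.* u (∣ P ∣) (double m) ℕ.∸ 1) ^ 3 →
  n ≤ (∣ V P (- + 1) (2 ℕ.* m) ∣ ℕ.+ ∣ U P (- + 1) (2 ℕ.* m) ∣ ℕ.* ∣ U P (- + 1) (2 ℕ.* m) ∣ ℕ.∸ 1) ^ 3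
lift-bound P m n = subst (λ j → n ≤ (∣ V P (- + 1) j ∣ ℕ.+ ∣ U P (- + 1) j ∣ ℕ.* ∣ U P (- + 1) j ∣ ℕ.∸ 1) ^ 3)
                      (double≡2* m)
              ∘ subst₂ (λ x y → n ≤ (x ℕ.+ y ℕ.* y ℕ.∸ 1) ^ 3) (sym (cong ∣_∣ (V-even P m))) (sym (∣U-even∣ P m))

second-form-indices : ∀ k r → let m = suc (k ℕ.+ r) in k ≢ r →
  (2 ℕ.* k ℕ.+ 1 ℕ.≤ 2 ℕ.* m) × (m ≢ 2 ℕ.* k ℕ.+ 1) × (2 ℕ.* m ℕ.∸ (2 ℕ.* k ℕ.+ 1) ≡ suc (double r))
second-form-indices k r k≢r =
  ℕ.≤-trans (ℕ.m≤m+n _ _) (ℕ.≤-reflexive (sym (2[1+k+r]≡ k r))) ,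
  (λ m≡ → k≢r (sym (ℕ.+-cancelˡ-≡ k r k (trans (ℕ.suc-injective (trans m≡ (ℕ.+-comm (2 ℕ.* k) 1))) (identity k))))) ,
  trans (cong (ℕ._∸ (2 ℕ.* k ℕ.+ 1)) (2[1+k+r]≡ k r)) (ℕ.m+n∸m≡n (2 ℕ.* k ℕ.+ 1) _)
  where
  identity : ∀ k → 2 ℕ.* k ≡ k ℕ.+ k
  identity = solve-∀

lift-first-form : ∀ P m n →
  (∃ λ k → n ≡ u (∣ P ∣) (suc (double k)) ℕ.* u (∣ P ∣) (suc (double (m ℕ.+ k)))
           × Prime (u (∣ P ∣) (suc (double k))) × Prime (u (∣ P ∣) (suc (double (m ℕ.+ k))))) →
  Σ ℕ (λ k → PrimeProduct P n (2 ℕ.* k ℕ.+ 1) (2 ℕ.* k ℕ.+ 2 ℕ.* m ℕ.+ 1))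
lift-first-form P m n (k , n≡ , prime-a , prime-d) =
  k , odd-prime-product P n k (m ℕ.+ k) (2k+1≡ k) (2k+2m+1≡ k m) n≡ prime-a prime-d

lift-second-form : ∀ P m n →
  (∃ λ k → ∃ λ r → suc (k ℕ.+ r) ≡ m × k ≢ r × n ≡ u (∣ P ∣) (suc (double k)) ℕ.* u (∣ P ∣) (suc (double r))
           × Prime (u (∣ P ∣) (suc (double k))) × Prime (u (∣ P ∣) (suc (double r)))) →
  Σ ℕ (λ k → (2 ℕ.* k ℕ.+ 1 ℕ.≤ 2 ℕ.* m) × (m ≢ 2 ℕ.* k ℕ.+ 1)
             × PrimeProduct P n (2 ℕ.* k ℕ.+ 1) (2 ℕ.* m ℕ.∸ (2 ℕ.* k ℕ.+ 1)))
lift-second-form P .(suc (k ℕ.+ r)) n (k , r , refl , k≢r , n≡ , prime-a , prime-d) =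
  let le , ne , diff = second-form-indices k r k≢r in
  k , le , ne , odd-prime-product P n k r (2k+1≡ k) diff n≡ prime-a prime-d

theorem1p3 : (P : ℤ) (m : ℕ) (n : ℕ) → 1 ≤ n →
    + (σ₂ n) - + n * + n ≡ V P (- + 1) (2 Data.Nat.* m) * + n - U P (- + 1) (2 Data.Nat.* m) * U P (- + 1) (2 Data.Nat.* m) + + 1 →
    (n ≤ (∣ V P (- + 1) (2 Data.Nat.* m) ∣ Data.Nat.+ ∣ U P (- + 1) (2 Data.Nat.* m) ∣ Data.Nat.* ∣ U P (- + 1) (2 Data.Nat.* m) ∣ Data.Nat.∸ 1) ^ 3)
    ⊎ (Σ ℕ (λ k → (+ n ≡ U P (- + 1) (2 Data.Nat.* k Data.Nat.+ 1) * U P (- + 1) (2 Data.Nat.* k Data.Nat.+ 2 Data.Nat.* m Data.Nat.+ 1)) × IsPrimeℤ (U P (- + 1) (2 Data.Nat.* k Data.Nat.+ 1)) × IsPrimeℤ (U P (- + 1) (2 Data.Nat.* k Data.Nat.+ 2 Data.Nat.* m Data.Nat.+ 1))))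
    ⊎ (Σ ℕ (λ k → (2 Data.Nat.* k Data.Nat.+ 1 ≤ 2 Data.Nat.* m) × (m ≢ 2 Data.Nat.* k Data.Nat.+ 1) × (+ n ≡ U P (- + 1) (2 Data.Nat.* k Data.Nat.+ 1) * U P (- + 1) (2 Data.Nat.* m Data.Nat.∸ (2 Data.Nat.* k Data.Nat.+ 1))) × IsPrimeℤ (U P (- + 1) (2 Data.Nat.* k Data.Nat.+ 1)) × IsPrimeℤ (U P (- + 1) (2 Data.Nat.* m Data.Nat.∸ (2 Data.Nat.* k Data.Nat.+ 1)))))
theorem1p3 P m n n≥1 eq =
  Sum.map (lift-bound P m n) (Sum.map (lift-first-form P m n) (lift-second-form P m n))
    (classification ∣ P ∣ m n n≥1 (natural-equation P m n eq))
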